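{- Let $a,b,c\in\mathbb{Z}$ be not all zero with $abc=0$ or $a+b+c=0$, and let $P(x,y,z)=x^2-xy+ax+by+cz$. If $a+b+c\neq0$ and $P$ satisfies the minimal Rado condition, then one of the following holds: (1) $a=b=0$; (2) at most one among $a,b,c$ is zero, and $0\in\{a+b,a+c,b+c\}$.
   Context: For $P=\sum c_\alpha x^\alpha\in\mathbb{Z}[x_1,\ldots,x_n]$: $\mathrm{Supp}(P)=\{\alpha\in\mathbb{N}_0^n:c_\alpha\ne0\}$ ($\mathbb{N}_0=\{0,1,2,\ldots\}$, $\mathbb{N}=\{1,2,\ldots\}$); $|\alpha|=\sum\alpha_i$; $\alpha!=\prod\alpha_i!$; $\tilde P(w)=P(w,\ldots,w)$ (here $\tilde P(w)=(a+b+c)w$); for $r\in\mathbb{Z}$, $\boldsymbol r=(r,\ldots,r)$ and $P^{(r)}(x)=P(x_1+r,\ldots,x_n+r)$, whose $x^\alpha$-coefficient is $\frac1{\alpha!}\frac{\partial^\alpha P}{\partial x^\alpha}(\boldsymbol r)$. A positive linear map is $\phi(\alpha)=t_1\alpha_1+\cdots+t_n\alpha_n$ with $t_i\in\mathbb{N}_0$; it is $c$-monochromatic for a finite coloring $c$ if $\{t_1,\ldots,t_n\}$ is. If $M_0<\cdots<M_\ell$ enumerates $\phi(\mathrm{Supp}(P))$, the partition determined by $\phi$ is $(J_0,\ldots,J_\ell)$, $J_i=\{\alpha\in\mathrm{Supp}(P):\phi(\alpha)=M_i\}$. A minimal (lower) Rado functional of order $m$ for $P$ is a tuple $(J_0,\ldots,J_\ell,d_1,\ldots,d_m)$,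 $\ell\ge m$, $d_i\in\mathbb{N}$, such that for every finite coloring $c$ of $\mathbb{N}$ and every $k\in\mathbb{N}$ there are infinitely many $c$-monochromatic positive linear maps $\phi$ determining $(J_0,\ldots,J_\ell)$ with $M_i-M_0=d_i$ ($1\le i\le m$) and $M_{m+1}-M_m\ge k$. When $\tilde P$ is nonzero and splits into linear factors over $\mathbb{Z}$, $P$ satisfies the minimal Rado condition if for every prime $p$ there exist a root $a\in\mathbb{Z}$ of $\tilde P$ and a minimal Rado functional $(J_0,\ldots,J_\ell,d_1,\ldots,d_m)$ for $P^{(a)}$ such that, with $d_0:=0$, $\sum_{i=0}^m p^{d_i}\sum_{\alpha\in J_i}\frac1{\alpha!}\frac{\partial^\alpha P}{\partial x^\alpha}(\boldsymbol a)w^{|\alpha|}=0$ has an invertible solution in the $p$-adic integers $\mathbb{Z}_p$. -}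

module Defs where

open import Data.Nat using (ℕ; zero; suc; _≤_; _<_; _∸_)
  renaming (_+_ to _+ℕ_; _*_ to _*ℕ_)
open import Data.Nat.Combinatorics using (_C_)
open import Data.Nat.Primality using (Prime)
open import Data.Integer using (ℤ; +_; _+_; _-_; _*_; _^_; -_)
open import Data.Integer.Divisibility using (_∣_)
open import Data.Fin using (Fin; zero; suc; toℕ; _↑ˡ_; _↑ʳ_; fromℕ)
  renaming (_<_ to _<ᶠ_)
open import Data.Vec using (Vec; []; _∷_; zipWith; foldr)
open import Data.List using (List; []; _∷_; map; allFin)
  renaming (foldr to foldrL)
open import Data.List.Membership.Propositional using (_∈_)
open import Data.List.Relation.Unary.Unique.Propositional using (Unique)
open import Data.Product using (Σ; ∃; _×_; _,_; proj₁; proj₂)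
open import Relation.Binary.PropositionalEquality using (_≡_; _≢_)
open import Relation.Nullary using (¬_)
open import Data.Vec.Relation.Unary.All using () renaming (All to AllV)
import Data.Nat

-- Integer polynomials in n variables, given as a finite list of terms
-- (coefficient , exponent vector).  The coefficient of x^α is the sum
-- of the coefficients of the terms with exponent α.

Poly : ℕ → Set
Poly n = List (ℤ × Vec ℕ n)

sumℤ : List ℤ → ℤ
sumℤ = foldrL _+_ (+ 0)

prodVℤ : ∀ {n} → Vec ℤ n → ℤ
prodVℤ = foldr _ _*_ (+ 1)

sumVℕ : ∀ {n} → Vec ℕ n → ℕ
sumVℕ = foldr _ _+ℕ_ 0

∣_∣ᵥ : ∀ {n} → Vec ℕ n → ℕ
∣ α ∣ᵥ = sumVℕ α

-- Coefficient of x^β in P^{(r)}(x) = P(x_1+r,…,x_n+r), i.e.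
--   (1/β!) ∂^β P (r,…,r) = Σ_{terms c x^α} c ∏_i C(α_i,β_i) r^(α_i-β_i)
-- (C(α_i,β_i) = 0 when β_i > α_i).
shiftCoeff : ∀ {n} → ℤ → Poly n → Vec ℕ n → ℤ
shiftCoeff r P β =
  sumℤ (map (λ t → proj₁ t * prodVℤ (zipWith (λ ai bi → + (ai C bi) * (r ^ (ai ∸ bi))) (proj₂ t) β)) P)

tildeEval : ∀ {n} → Poly n → ℤ → ℤ
tildeEval P w = sumℤ (map (λ t → proj₁ t * (w ^ ∣ proj₂ t ∣ᵥ)) P)

φ : ∀ {n} → Vec ℕ n → Vec ℕ n → ℕ
φ t α = sumVℕ (zipWith _*ℕ_ t α)

-- {t_1,…,t_n} is c-monochromatic for a finite colouring c of ℕ = {1,2,…}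
-- (so every t_i must be a positive integer).
Monochromatic : ∀ {n nc} → (ℕ → Fin nc) → Vec ℕ n → Set
Monochromatic {nc = nc} col t =
  Σ (Fin nc) λ κ → AllV (λ ti → (1 ≤ ti) × (col ti ≡ κ)) t

-- A functional (J_0,…,J_ℓ,d_1,…,d_m) with ℓ = m + r (so ℓ ≥ m) is
-- J : Fin (suc m + r) → List (Vec ℕ n)  (each J_i a duplicate-free list,
-- i.e. a finite set of exponent vectors) and d : Fin m → ℕ (d_1,…,d_m).

dd : ∀ {m} → (Fin m → ℕ) → Fin (suc m) → ℕ
dd d zero = 0
dd d (suc i) = d i

-- φ (given by t) determines the partition (J_0,…,J_ℓ) of Supp(coef),
-- with M_0 < ⋯ < M_ℓ enumerating φ(Supp), M_i − M_0 = d_i (1 ≤ i ≤ m)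
-- and M_{m+1} − M_m ≥ k (when ℓ > m).
DeterminesWith : ∀ {n} (coef : Vec ℕ n → ℤ) (m r : ℕ)
  (J : Fin (suc m +ℕ r) → List (Vec ℕ n)) (d : Fin m → ℕ) (k : ℕ) (t : Vec ℕ n) → Set
DeterminesWith {n} coef m r J d k t =
  Σ (Fin (suc m +ℕ r) → ℕ) λ M →
    (∀ i j → i <ᶠ j → M i < M j)
  × (∀ j → J j ≢ [])
  × (∀ j (α : Vec ℕ n) → α ∈ J j → (coef α ≢ + 0) × (φ t α ≡ M j))
  × (∀ (α : Vec ℕ n) → coef α ≢ + 0 → Σ (Fin (suc m +ℕ r)) λ j → α ∈ J j)
  × (∀ (i : Fin (suc m)) → M (i ↑ˡ r) ≡ M zero +ℕ dd d i)
  × (∀ (j : Fin r) → toℕ j ≡ 0 → k +ℕ M (fromℕ m ↑ˡ r) ≤ M (suc m ↑ʳ j))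

-- Minimal (lower) Rado functional of order m for the polynomial with
-- coefficient function coef.  "Infinitely many maps φ" is rendered as:
-- for every bound B there is such a φ with t_1+⋯+t_n ≥ B.
IsMinimalRadoFunctional : ∀ {n} (coef : Vec ℕ n → ℤ) (m r : ℕ)
  (J : Fin (suc m +ℕ r) → List (Vec ℕ n)) (d : Fin m → ℕ) → Set
IsMinimalRadoFunctional {n} coef m r J d =
    (∀ i → 1 ≤ d i)
  × (∀ j → Unique (J j))
  × (∀ (nc : ℕ) (col : ℕ → Fin nc) (k B : ℕ) →
       Σ (Vec ℕ n) λ t → (B ≤ sumVℕ t) × Monochromatic col t × DeterminesWith coef m r J d k t)

radoEquation : ∀ {n} (coef : Vec ℕ n → ℤ) (m r : ℕ)
  (J : Fin (suc m +ℕ r) → List (Vec ℕ n)) (d : Fin m → ℕ) (p : ℕ) → ℤ → ℤ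
radoEquation coef m r J d p w =
  sumℤ (map (λ i → ((+ p) ^ dd d i) * sumℤ (map (λ α → coef α * (w ^ ∣ α ∣ᵥ)) (J (i ↑ˡ r))))
            (allFin (suc m)))

-- p-adic integers as the inverse limit lim ℤ/p^k: a sequence x_k ∈ ℤ
-- (x_k representing an element of ℤ/p^k) with x_{k+1} ≡ x_k mod p^k.
-- For f given by an integer polynomial, f(x) = 0 in ℤ_p iff
-- p^k ∣ f(x_k) for all k; x is invertible iff p ∤ x_1.
HasInvertiblePadicRoot : ℕ → (ℤ → ℤ) → Set
HasInvertiblePadicRoot p f =
  Σ (ℕ → ℤ) λ x →
    (∀ k → (+ (p Data.Nat.^ k)) ∣ (x (suc k) - x k))
  × (∀ k → (+ (p Data.Nat.^ k)) ∣ f (x k))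
  × ¬ ((+ p) ∣ x 1)

MinimalRadoCondition : ∀ {n} → Poly n → Set
MinimalRadoCondition {n} P =
  ∀ (p : ℕ) → Prime p →
    Σ ℤ λ a → (tildeEval P a ≡ + 0) ×
      Σ ℕ λ m → Σ ℕ λ r → Σ (Fin (suc m +ℕ r) → List (Vec ℕ n)) λ J → Σ (Fin m → ℕ) λ d →
        IsMinimalRadoFunctional (shiftCoeff a P) m r J d
      × HasInvertiblePadicRoot p (radoEquation (shiftCoeff a P) m r J d p)

Pabc : ℤ → ℤ → ℤ → Poly 3
Pabc a b c =
    (+ 1 , 2 ∷ 0 ∷ 0 ∷ [])
  ∷ (- (+ 1) , 1 ∷ 1 ∷ 0 ∷ [])
  ∷ (a , 1 ∷ 0 ∷ 0 ∷ [])
  ∷ (b , 0 ∷ 1 ∷ 0 ∷ [])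
  ∷ (c , 0 ∷ 0 ∷ 1 ∷ [])
  ∷ []

{-# OPTIONS --safe #-}
-- Since a + b + c ≠ 0, P̃(w) = (a + b + c) w has 0 as its only root, so the minimal Rado
-- condition at a prime p > |a| + |b| + |c| gives a minimal Rado functional for P itself and an
-- invertible p-adic solution w. Every level J_i with i ≥ 1 carries the factor p^{d_i}, d_i ≥ 1,
-- so p divides the lowest-level part Σ_{α ∈ J₀} c_α w^{|α|}. Colour n by the parity of
-- ⌊log₂ n⌋: a monochromatic φ has t₂, t₃ ≠ 2 t₁, so x² never shares the lowest level with y or z,
-- and x², xy lie strictly above x or y whenever those occur in P. In each case excluded by the
-- conclusion the lowest-level part is therefore w² or e w with e ∈ {a, b, c, a + b, a + c, b + c}
-- nonzero; as p ∤ w and 0 < |e| < p, p divides neither.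

module Submission where

open import Defs
open import Data.Empty using (⊥; ⊥-elim)
open import Data.Fin using (Fin; zero; suc; _↑ˡ_)
open import Data.Integer using (ℤ; +_; -_; _+_; _*_; _^_; ∣_∣)
open import Data.Integer.Divisibility using (_∣_)
import Data.Integer.Divisibility.Signed as Signed
import Data.Integer.Properties as ℤ
open import Data.Integer.Tactic.RingSolver using (solve-∀)
import Data.Nat.Tactic.RingSolver as ℕ-Solver
open import Data.List using (List; []; _∷_; map; tabulate)
open import Data.List.Membership.Propositional using (_∈_; _∉_)
open import Data.List.Relation.Unary.All using (All; []; _∷_)
open import Data.List.Relation.Unary.All.Properties using (map⁺; tabulate⁺)
open import Data.List.Relation.Unary.AllPairs using ([]; _∷_)
open import Data.List.Relation.Unary.Any using (here; there)
open import Data.List.Relation.Unary.Unique.Propositional using (Unique)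
open import Data.Nat as ℕ using (ℕ; zero; suc; _≤_; _<_; _!; _∸_; z≤n; s≤s)
open import Data.Nat.Combinatorics using (_C_; k>n⇒nCk≡0)
open import Data.Nat.Divisibility as ℕ∣ using () renaming (_∣_ to _∣ℕ_)
open import Data.Nat.Logarithm using (⌊log₂_⌋; ⌊log₂[2*b]⌋≡1+⌊log₂b⌋)
open import Data.Nat.Primality using (Prime; euclidsLemma; prime⇒nonZero; ¬prime[1])
open import Data.Nat.Primality.Factorisation using (factorise)
import Data.Nat.Properties as ℕ
open import Data.Product using (∃-syntax; _×_; _,_; proj₁; proj₂)
open import Data.Sum using (_⊎_; inj₁; inj₂; [_,_]′)
import Data.Sum as Sum
open import Data.Vec using (Vec; []; _∷_; zipWith)
open import Data.Vec.Properties using (≡-dec)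
open import Data.Vec.Relation.Unary.All using ([]; _∷_)
open import Data.List.Membership.DecPropositional (≡-dec {n = 3} ℕ._≟_) using (_∈?_)
open import Relation.Binary.PropositionalEquality
open import Relation.Binary.Definitions using (tri<; tri≈; tri>)
open import Function using (_∘_; id)
open import Relation.Nullary using (¬_; yes; no)
open import Relation.Nullary.Decidable using (toSum)

-- Arbitrarily large primes

m∣n! : ∀ {m n} → 1 ≤ m → m ≤ n → m ∣ℕ n !
m∣n! {suc k} _ m≤n = ℕ∣.∣-trans (ℕ∣.m∣m*n (k !)) (ℕ∣.m≤n⇒m!∣n! m≤n)

prime∣suc[n!]⇒n< : ∀ {n p} → Prime p → p ∣ℕ suc (n !) → n < p
prime∣suc[n!]⇒n< {n} {p} p-prime p∣ with p ℕ.≤? n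
... | no p≰n = ℕ.≰⇒> p≰n
... | yes p≤n = ⊥-elim (¬prime[1] (subst Prime (ℕ∣.∣1⇒≡1 p∣1) p-prime))
  where
  p∣1 : p ∣ℕ 1
  p∣1 = ℕ∣.∣m+n∣m⇒∣n (subst (p ∣ℕ_) (ℕ.+-comm 1 (n !)) p∣)
          (m∣n! (ℕ.>-nonZero⁻¹ p {{prime⇒nonZero p-prime}}) p≤n)

primes-unbounded : ∀ n → ∃[ p ] Prime p × n < p
primes-unbounded n with factorise (suc (n !))
... | record { factors = [] ; isFactorisation = eq } =
  ⊥-elim (ℕ.<⇒≢ (ℕ.1≤n! n) (sym (ℕ.suc-injective eq)))
... | record { factors = p ∷ ps ; isFactorisation = eq ; factorsPrime = p-prime ∷ _ } =
  p , p-prime , prime∣suc[n!]⇒n< p-prime (subst (p ∣ℕ_) (sym eq) (ℕ∣.m∣m*n _))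

-- A colouring that separates t from 2t

parity : ℕ → Fin 2
parity zero = zero
parity (suc zero) = suc zero
parity (suc (suc n)) = parity n

parity-suc : ∀ n → parity (suc n) ≢ parity n
parity-suc zero ()
parity-suc (suc zero) ()
parity-suc (suc (suc n)) = parity-suc n

log₂-parity : ℕ → Fin 2
log₂-parity n = parity ⌊log₂ n ⌋

log₂-parity-double : ∀ {t} → 1 ≤ t → log₂-parity (t ℕ.+ t) ≢ log₂-parity t
log₂-parity-double {t@(suc _)} _ = subst (_≢ log₂-parity t) (cong parity log₂[t+t]) (parity-suc ⌊log₂ t ⌋)
  where
  log₂[t+t] : suc ⌊log₂ t ⌋ ≡ ⌊log₂ (t ℕ.+ t) ⌋
  log₂[t+t] = trans (sym (⌊log₂[2*b]⌋≡1+⌊log₂b⌋ t)) (cong (λ s → ⌊log₂ (t ℕ.+ s) ⌋) (ℕ.+-identityʳ t))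

-- Taylor coefficients at 0

shiftFactor₀ : ℕ → ℕ → ℤ
shiftFactor₀ m k = + (m C k) * ((+ 0) ^ (m ∸ k))

shiftFactor₀-≢ : ∀ {m k} → m ≢ k → shiftFactor₀ m k ≡ + 0
shiftFactor₀-≢ {m} {k} m≢k with ℕ.<-cmp m k
... | tri< m<k _ _ = cong (λ n → (+ n) * ((+ 0) ^ (m ∸ k))) (k>n⇒nCk≡0 m<k)
... | tri≈ _ m≡k _ = ⊥-elim (m≢k m≡k)
... | tri> _ _ k<m = trans (cong (+ (m C k) *_) (0^n≡0 (ℕ.m>n⇒m∸n≢0 k<m))) (ℤ.*-zeroʳ (+ (m C k)))
  where
  0^n≡0 : ∀ {n} → n ≢ 0 → (+ 0) ^ n ≡ + 0
  0^n≡0 {zero} n≢0 = ⊥-elim (n≢0 refl)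
  0^n≡0 {suc n} _ = refl

shiftProduct₀-≢ : ∀ {n} {α β : Vec ℕ n} → α ≢ β → prodVℤ (zipWith shiftFactor₀ α β) ≡ + 0
shiftProduct₀-≢ {α = []} {[]} α≢β = ⊥-elim (α≢β refl)
shiftProduct₀-≢ {α = m ∷ α} {k ∷ β} mα≢kβ with m ℕ.≟ k
... | no m≢k rewrite shiftFactor₀-≢ m≢k = refl
... | yes refl = trans (cong (shiftFactor₀ m m *_) (shiftProduct₀-≢ (mα≢kβ ∘ cong (m ∷_))))
                       (ℤ.*-zeroʳ (shiftFactor₀ m m))

shiftCoeff₀-support : ∀ {n} (P : Poly n) β → shiftCoeff (+ 0) P β ≢ + 0 → β ∈ map proj₂ P
shiftCoeff₀-support [] β nonzero = ⊥-elim (nonzero refl)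
shiftCoeff₀-support ((c , α) ∷ P) β nonzero with ≡-dec ℕ._≟_ β α
... | yes refl = here refl
... | no β≢α = there (shiftCoeff₀-support P β λ rest≡0 → nonzero (begin
  c * prodVℤ (zipWith shiftFactor₀ α β) + shiftCoeff (+ 0) P β
    ≡⟨ cong₂ (λ u v → c * u + v) (shiftProduct₀-≢ (β≢α ∘ sym)) rest≡0 ⟩
  c * + 0 + + 0
    ≡⟨ cong (_+ + 0) (ℤ.*-zeroʳ c) ⟩
  + 0 ∎))
  where open ≡-Reasoning

-- The lowest level of a minimal Rado functional

record LowestLevel {n} (coef : Vec ℕ n → ℤ) (t : Vec ℕ n) (L : List (Vec ℕ n)) : Set where
  field
    unique    : Unique L
    nonempty  : L ≢ []
    supported : ∀ {α} → α ∈ L → coef α ≢ + 0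
    minimal   : ∀ {α β} → α ∈ L → coef β ≢ + 0 → φ t α ≤ φ t β

  lower⇒∉ : ∀ {α β} → coef β ≢ + 0 → φ t β < φ t α → α ∉ L
  lower⇒∉ β-supported β<α α∈L = ℕ.<⇒≱ β<α (minimal α∈L β-supported)

  unsupported⇒∉ : ∀ {α} → coef α ≡ + 0 → α ∉ L
  unsupported⇒∉ α-unsupported α∈L = supported α∈L α-unsupported

  same-level : ∀ {α β} → α ∈ L → β ∈ L → φ t α ≡ φ t β
  same-level α∈L β∈L = ℕ.≤-antisym (minimal α∈L (supported β∈L)) (minimal β∈L (supported α∈L))

determines⇒lowestLevel : ∀ {n coef m r J d k t} → (∀ j → Unique (J j)) →
  DeterminesWith {n} coef m r J d k t → LowestLevel coef t (J zero)
determines⇒lowestLevel {coef = coef} {J = J} {t = t} unique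
  (M , M-mono , nonempty , level , cover , _) = record
  { unique    = unique zero
  ; nonempty  = nonempty zero
  ; supported = λ α∈J₀ → proj₁ (level zero _ α∈J₀)
  ; minimal   = minimal
  }
  where
  M₀≤ : ∀ j → M zero ≤ M j
  M₀≤ zero    = ℕ.≤-refl
  M₀≤ (suc j) = ℕ.<⇒≤ (M-mono zero (suc j) (s≤s z≤n))

  minimal : ∀ {α β} → α ∈ J zero → coef β ≢ + 0 → φ t α ≤ φ t β
  minimal {α} {β} α∈J₀ β-supported with cover β β-supported
  ... | j , β∈Jⱼ = subst₂ _≤_ (sym (proj₂ (level zero α α∈J₀))) (sym (proj₂ (level j β β∈Jⱼ))) (M₀≤ j)

levelSum : ∀ {n} → (Vec ℕ n → ℤ) → List (Vec ℕ n) → ℤ → ℤ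
levelSum coef L w = sumℤ (map (λ α → coef α * w ^ ∣ α ∣ᵥ) L)

∣sumℤ : ∀ {k xs} → All (k Signed.∣_) xs → k Signed.∣ sumℤ xs
∣sumℤ []         = Signed.divides (+ 0) refl
∣sumℤ (k∣x ∷ k∣xs) = Signed.∣m∣n⇒∣m+n k∣x (∣sumℤ k∣xs)

i∣i^n*j : ∀ {i n} j → 1 ≤ n → i Signed.∣ i ^ n * j
i∣i^n*j {i} {suc n} j _ = Signed.∣m⇒∣m*n j (Signed.∣m⇒∣m*n (i ^ n) Signed.∣-refl)

p∣radoEquation⇒p∣levelSum₀ : ∀ {n} {coef : Vec ℕ n → ℤ} {m r J d p w} → (∀ i → 1 ≤ d i) →
  + p ∣ radoEquation coef m r J d p w → + p ∣ levelSum coef (J zero) w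
p∣radoEquation⇒p∣levelSum₀ {coef = coef} {m} {r} {J} {d} {p} {w} d≥1 p∣rado =
  Signed.∣⇒∣ᵤ (subst (+ p Signed.∣_) (ℤ.*-identityˡ (levelSum coef (J zero) w))
    (Signed.∣m+n∣n⇒∣m {m = term zero} (Signed.∣ᵤ⇒∣ p∣rado) p∣higher-levels))
  where
  term : Fin (suc m) → ℤ
  term i = (+ p) ^ dd d i * levelSum coef (J (i ↑ˡ r)) w

  p∣higher-levels : + p Signed.∣ sumℤ (map term (tabulate suc))
  p∣higher-levels = ∣sumℤ (map⁺ (tabulate⁺ λ i → i∣i^n*j (levelSum coef (J (suc i ↑ˡ r)) w) (d≥1 i)))

invertibleRoot⇒p∣levelSum₀ : ∀ {n} {coef : Vec ℕ n → ℤ} {m r J d p} → (∀ i → 1 ≤ d i) →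
  HasInvertiblePadicRoot p (radoEquation coef m r J d p) →
  ∃[ w ] ¬ (+ p ∣ w) × + p ∣ levelSum coef (J zero) w
invertibleRoot⇒p∣levelSum₀ {coef = coef} {m} {r} {J} {d} {p} d≥1 (x , _ , p^k∣ , p∤x₁) =
  x 1 , p∤x₁ , p∣radoEquation⇒p∣levelSum₀ {coef = coef} {m} {r} {J} {d} d≥1
    (subst (_∣ℕ ∣ radoEquation coef m r J d p (x 1) ∣) (ℕ.*-identityʳ p) (p^k∣ 1))

module _ {A : Set} (f : A → ℤ) where

  sum-unique-⊆[u] : ∀ {u L} → Unique L → L ≢ [] → (∀ {α} → α ∈ L → α ≡ u) →
    sumℤ (map f L) ≡ f u
  sum-unique-⊆[u] {L = []}        _ L≢[] _ = ⊥-elim (L≢[] refl)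
  sum-unique-⊆[u] {L = α ∷ []}    _ _ ⊆u rewrite ⊆u (here refl) = ℤ.+-identityʳ _
  sum-unique-⊆[u] {L = α ∷ β ∷ _} ((α≢β ∷ _) ∷ _) _ ⊆u =
    ⊥-elim (α≢β (trans (⊆u (here refl)) (sym (⊆u (there (here refl))))))

  sum-unique-⊆[u,v] : ∀ {u v L} → Unique L → L ≢ [] → (∀ {α} → α ∈ L → α ≡ u ⊎ α ≡ v) →
    sumℤ (map f L) ≡ f u ⊎ sumℤ (map f L) ≡ f v ⊎ sumℤ (map f L) ≡ f u + f v
  sum-unique-⊆[u,v] {L = []} _ L≢[] _ = ⊥-elim (L≢[] refl)
  sum-unique-⊆[u,v] {L = α ∷ []} _ _ ⊆uv with ⊆uv (here refl)
  ... | inj₁ refl = inj₁ (ℤ.+-identityʳ (f α))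
  ... | inj₂ refl = inj₂ (inj₁ (ℤ.+-identityʳ (f α)))
  sum-unique-⊆[u,v] {L = α ∷ β ∷ []} ((α≢β ∷ []) ∷ _) _ ⊆uv
    with ⊆uv (here refl) | ⊆uv (there (here refl))
  ... | inj₁ refl | inj₁ refl = ⊥-elim (α≢β refl)
  ... | inj₂ refl | inj₂ refl = ⊥-elim (α≢β refl)
  ... | inj₁ refl | inj₂ refl = inj₂ (inj₂ (cong (λ s → f α + s) (ℤ.+-identityʳ (f β))))
  ... | inj₂ refl | inj₁ refl =
    inj₂ (inj₂ (trans (cong (λ s → f α + s) (ℤ.+-identityʳ (f β))) (ℤ.+-comm (f α) (f β))))
  sum-unique-⊆[u,v] {L = α ∷ β ∷ γ ∷ _} ((α≢β ∷ α≢γ ∷ _) ∷ (β≢γ ∷ _) ∷ _) _ ⊆uv =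
    ⊥-elim ([ α≢β , [ α≢γ , β≢γ ]′ ]′
      (pigeonhole (⊆uv (here refl)) (⊆uv (there (here refl))) (⊆uv (there (there (here refl))))))
    where
    pigeonhole : ∀ {u v α β γ : A} → α ≡ u ⊎ α ≡ v → β ≡ u ⊎ β ≡ v → γ ≡ u ⊎ γ ≡ v →
      α ≡ β ⊎ α ≡ γ ⊎ β ≡ γ
    pigeonhole (inj₁ refl) (inj₁ refl) _           = inj₁ refl
    pigeonhole (inj₂ refl) (inj₂ refl) _           = inj₁ refl
    pigeonhole (inj₁ refl) (inj₂ refl) (inj₁ refl) = inj₂ (inj₁ refl)
    pigeonhole (inj₁ refl) (inj₂ refl) (inj₂ refl) = inj₂ (inj₂ refl)
    pigeonhole (inj₂ refl) (inj₁ refl) (inj₁ refl) = inj₂ (inj₂ refl)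
    pigeonhole (inj₂ refl) (inj₁ refl) (inj₂ refl) = inj₂ (inj₁ refl)

prime∤* : ∀ {p} i j → Prime p → ¬ (+ p ∣ i) → ¬ (+ p ∣ j) → ¬ (+ p ∣ i * j)
prime∤* {p} i j p-prime p∤i p∤j p∣ij
  with euclidsLemma ∣ i ∣ ∣ j ∣ p-prime (subst (p ∣ℕ_) (ℤ.abs-* i j) p∣ij)
... | inj₁ p∣i = p∤i p∣i
... | inj₂ p∣j = p∤j p∣j

>∣i∣⇒∤ : ∀ {p i} → i ≢ + 0 → ∣ i ∣ < p → ¬ (+ p ∣ i)
>∣i∣⇒∤ i≢0 = ℕ∣.>⇒∤ {{ℕ.≢-nonZero (i≢0 ∘ ℤ.∣i∣≡0⇒i≡0)}}

i*j≡0⇒i≡0∨j≡0 : ∀ i {j} → i * j ≡ + 0 → i ≡ + 0 ⊎ j ≡ + 0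
i*j≡0⇒i≡0∨j≡0 i {j} i*j≡0 = Sum.map ℤ.∣i∣≡0⇒i≡0 ℤ.∣i∣≡0⇒i≡0
  (ℕ.m*n≡0⇒m≡0∨n≡0 ∣ i ∣ (trans (sym (ℤ.abs-* i j)) (cong ∣_∣ i*j≡0)))

x² xy x y z : Vec ℕ 3
x² = 2 ∷ 0 ∷ 0 ∷ []
xy = 1 ∷ 1 ∷ 0 ∷ []
x  = 1 ∷ 0 ∷ 0 ∷ []
y  = 0 ∷ 1 ∷ 0 ∷ []
z  = 0 ∷ 0 ∷ 1 ∷ []

data MonomialOfP : Vec ℕ 3 → Set where
  x²∈P : MonomialOfP x²
  xy∈P : MonomialOfP xy
  x∈P  : MonomialOfP x
  y∈P  : MonomialOfP y
  z∈P  : MonomialOfP z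

coeffP : ℤ → ℤ → ℤ → Vec ℕ 3 → ℤ
coeffP a b c = shiftCoeff (+ 0) (Pabc a b c)

coeffP-support : ∀ a b c {β} → coeffP a b c β ≢ + 0 → MonomialOfP β
coeffP-support a b c {β} β-supported with shiftCoeff₀-support (Pabc a b c) β β-supported
... | here refl                                 = x²∈P
... | there (here refl)                         = xy∈P
... | there (there (here refl))                 = x∈P
... | there (there (there (here refl)))         = y∈P
... | there (there (there (there (here refl)))) = z∈P

-- The ring solvers do not unfold definitions, so the following facts are proved on
-- the normal forms of their left-hand sides.

coeffP-x² : ∀ a b c → coeffP a b c x² ≡ + 1
coeffP-x² = normal-form
  where
  normal-form : ∀ a b c →
    + 1 * + 1 + (- + 1 * + 0 + (a * + 0 + (b * + 0 + (c * + 0 + + 0)))) ≡ + 1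
  normal-form = solve-∀

coeffP-x : ∀ a b c → coeffP a b c x ≡ a
coeffP-x = normal-form
  where
  normal-form : ∀ a b c →
    + 1 * + 0 + (- + 1 * + 0 + (a * + 1 + (b * + 0 + (c * + 0 + + 0)))) ≡ a
  normal-form = solve-∀

coeffP-y : ∀ a b c → coeffP a b c y ≡ b
coeffP-y = normal-form
  where
  normal-form : ∀ a b c →
    + 1 * + 0 + (- + 1 * + 0 + (a * + 0 + (b * + 1 + (c * + 0 + + 0)))) ≡ b
  normal-form = solve-∀

coeffP-z : ∀ a b c → coeffP a b c z ≡ c
coeffP-z = normal-form
  where
  normal-form : ∀ a b c →
    + 1 * + 0 + (- + 1 * + 0 + (a * + 0 + (b * + 0 + (c * + 1 + + 0)))) ≡ c
  normal-form = solve-∀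

tildeEval-Pabc : ∀ a b c w → tildeEval (Pabc a b c) w ≡ (a + b + c) * w
tildeEval-Pabc = normal-form
  where
  normal-form : ∀ a b c w →
    + 1 * (w * (w * + 1)) + (- + 1 * (w * (w * + 1)) + (a * (w * + 1) + (b * (w * + 1)
      + (c * (w * + 1) + + 0)))) ≡ (a + b + c) * w
  normal-form = solve-∀

P̃-root≡0 : ∀ {a b c w} → a + b + c ≢ + 0 → tildeEval (Pabc a b c) w ≡ + 0 → w ≡ + 0
P̃-root≡0 {a} {b} {c} {w} sum≢0 P̃[w]≡0 =
  [ ⊥-elim ∘ sum≢0 , id ]′ (i*j≡0⇒i≡0∨j≡0 (a + b + c) (trans (sym (tildeEval-Pabc a b c w)) P̃[w]≡0))

module _ (t₁ t₂ t₃ : ℕ) where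
  private
    t : Vec ℕ 3
    t = t₁ ∷ t₂ ∷ t₃ ∷ []

  φ-x² : φ t x² ≡ t₁ ℕ.+ t₁
  φ-x² = normal-form t₁ t₂ t₃
    where
    normal-form : ∀ t₁ t₂ t₃ → t₁ ℕ.* 2 ℕ.+ (t₂ ℕ.* 0 ℕ.+ (t₃ ℕ.* 0 ℕ.+ 0)) ≡ t₁ ℕ.+ t₁
    normal-form = ℕ-Solver.solve-∀

  φ-xy : φ t xy ≡ t₁ ℕ.+ t₂
  φ-xy = normal-form t₁ t₂ t₃
    where
    normal-form : ∀ t₁ t₂ t₃ → t₁ ℕ.* 1 ℕ.+ (t₂ ℕ.* 1 ℕ.+ (t₃ ℕ.* 0 ℕ.+ 0)) ≡ t₁ ℕ.+ t₂
    normal-form = ℕ-Solver.solve-∀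

  φ-x : φ t x ≡ t₁
  φ-x = normal-form t₁ t₂ t₃
    where
    normal-form : ∀ t₁ t₂ t₃ → t₁ ℕ.* 1 ℕ.+ (t₂ ℕ.* 0 ℕ.+ (t₃ ℕ.* 0 ℕ.+ 0)) ≡ t₁
    normal-form = ℕ-Solver.solve-∀

  φ-y : φ t y ≡ t₂
  φ-y = normal-form t₁ t₂ t₃
    where
    normal-form : ∀ t₁ t₂ t₃ → t₁ ℕ.* 0 ℕ.+ (t₂ ℕ.* 1 ℕ.+ (t₃ ℕ.* 0 ℕ.+ 0)) ≡ t₂
    normal-form = ℕ-Solver.solve-∀

  φ-z : φ t z ≡ t₃
  φ-z = normal-form t₁ t₂ t₃
    where
    normal-form : ∀ t₁ t₂ t₃ → t₁ ℕ.* 0 ℕ.+ (t₂ ℕ.* 0 ℕ.+ (t₃ ℕ.* 1 ℕ.+ 0)) ≡ t₃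
    normal-form = ℕ-Solver.solve-∀

-- The exceptional coefficient patterns admit no lowest level

data Exceptional (a b c : ℤ) : Set where
  only-a-nonzero : b ≡ + 0 → c ≡ + 0 → a ≢ + 0 → Exceptional a b c
  only-b-nonzero : a ≡ + 0 → c ≡ + 0 → b ≢ + 0 → Exceptional a b c
  only-a-zero    : a ≡ + 0 → b ≢ + 0 → c ≢ + 0 → b + c ≢ + 0 → Exceptional a b c
  only-b-zero    : b ≡ + 0 → a ≢ + 0 → c ≢ + 0 → a + c ≢ + 0 → Exceptional a b c
  only-c-zero    : c ≡ + 0 → a ≢ + 0 → b ≢ + 0 → a + b ≢ + 0 → Exceptional a b c

module LowestLevelOfP
  {a b c : ℤ} {p : ℕ} (p-prime : Prime p) (p-large : ∣ a ∣ ℕ.+ ∣ b ∣ ℕ.+ ∣ c ∣ < p)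
  {t₁ t₂ t₃ : ℕ} (t₁≥1 : 1 ≤ t₁) (t₂≥1 : 1 ≤ t₂) (t₂≢2t₁ : t₂ ≢ t₁ ℕ.+ t₁) (t₃≢2t₁ : t₃ ≢ t₁ ℕ.+ t₁)
  {L : List (Vec ℕ 3)} (lowest : LowestLevel (coeffP a b c) (t₁ ∷ t₂ ∷ t₃ ∷ []) L)
  {w : ℤ} (p∤w : ¬ (+ p ∣ w)) (p∣S : + p ∣ levelSum (coeffP a b c) L w)
  where

  open LowestLevel lowest

  N : ℕ
  N = ∣ a ∣ ℕ.+ ∣ b ∣ ℕ.+ ∣ c ∣

  term : Vec ℕ 3 → ℤ
  term α = coeffP a b c α * w ^ ∣ α ∣ᵥ

  monomial : ∀ {α} → α ∈ L → MonomialOfP α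
  monomial α∈L = coeffP-support a b c (supported α∈L)

  x-supported : a ≢ + 0 → coeffP a b c x ≢ + 0
  x-supported = subst (_≢ + 0) (sym (coeffP-x a b c))

  y-supported : b ≢ + 0 → coeffP a b c y ≢ + 0
  y-supported = subst (_≢ + 0) (sym (coeffP-y a b c))

  x∉L : a ≡ + 0 → x ∉ L
  x∉L a≡0 = unsupported⇒∉ (trans (coeffP-x a b c) a≡0)

  y∉L : b ≡ + 0 → y ∉ L
  y∉L b≡0 = unsupported⇒∉ (trans (coeffP-y a b c) b≡0)

  z∉L : c ≡ + 0 → z ∉ L
  z∉L c≡0 = unsupported⇒∉ (trans (coeffP-z a b c) c≡0)

  x²∉L : a ≢ + 0 → x² ∉ L
  x²∉L a≢0 = lower⇒∉ {x²} {x} (x-supported a≢0)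
    (subst₂ _<_ (sym (φ-x t₁ t₂ t₃)) (sym (φ-x² t₁ t₂ t₃)) (ℕ.m<m+n t₁ t₁≥1))

  xy∉L : a ≢ + 0 ⊎ b ≢ + 0 → xy ∉ L
  xy∉L (inj₁ a≢0) = lower⇒∉ {xy} {x} (x-supported a≢0)
    (subst₂ _<_ (sym (φ-x t₁ t₂ t₃)) (sym (φ-xy t₁ t₂ t₃)) (ℕ.m<m+n t₁ t₂≥1))
  xy∉L (inj₂ b≢0) = lower⇒∉ {xy} {y} (y-supported b≢0)
    (subst₂ _<_ (sym (φ-y t₁ t₂ t₃)) (sym (φ-xy t₁ t₂ t₃)) (ℕ.m<n+m t₂ t₁≥1))

  x²∈L⇒y∉L : x² ∈ L → y ∉ L
  x²∈L⇒y∉L x²∈L y∈L =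
    t₂≢2t₁ (trans (sym (φ-y t₁ t₂ t₃)) (trans (same-level y∈L x²∈L) (φ-x² t₁ t₂ t₃)))

  x²∈L⇒z∉L : x² ∈ L → z ∉ L
  x²∈L⇒z∉L x²∈L z∈L =
    t₃≢2t₁ (trans (sym (φ-z t₁ t₂ t₃)) (trans (same-level z∈L x²∈L) (φ-x² t₁ t₂ t₃)))

  term-x² : term x² ≡ w * w
  term-x² = trans (cong (_* w ^ 2) (coeffP-x² a b c))
                  (trans (ℤ.*-identityˡ (w ^ 2)) (cong (w *_) (ℤ.^-identityʳ w)))

  term-x : term x ≡ a * w
  term-x = cong₂ _*_ (coeffP-x a b c) (ℤ.^-identityʳ w)

  term-y : term y ≡ b * w
  term-y = cong₂ _*_ (coeffP-y a b c) (ℤ.^-identityʳ w)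

  term-z : term z ≡ c * w
  term-z = cong₂ _*_ (coeffP-z a b c) (ℤ.^-identityʳ w)

  refute-x² : (∀ {α} → α ∈ L → α ≡ x²) → ⊥
  refute-x² ⊆x² = prime∤* w w p-prime p∤w p∤w
    (subst (+ p ∣_) (trans (sum-unique-⊆[u] term unique nonempty ⊆x²) term-x²) p∣S)

  refute-linear : ∀ {e} → levelSum (coeffP a b c) L w ≡ e * w → e ≢ + 0 → ∣ e ∣ ≤ N → ⊥
  refute-linear {e} S≡ew e≢0 ∣e∣≤N =
    prime∤* e w p-prime (>∣i∣⇒∤ e≢0 (ℕ.≤-<-trans ∣e∣≤N p-large)) p∤w (subst (+ p ∣_) S≡ew p∣S)

  refute-single : ∀ {u e} → (∀ {α} → α ∈ L → α ≡ u) → term u ≡ e * w → e ≢ + 0 → ∣ e ∣ ≤ N → ⊥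
  refute-single ⊆u term-u = refute-linear (trans (sum-unique-⊆[u] term unique nonempty ⊆u) term-u)

  refute-pair : ∀ {u v e₁ e₂} → (∀ {α} → α ∈ L → α ≡ u ⊎ α ≡ v) → term u ≡ e₁ * w → term v ≡ e₂ * w →
    e₁ ≢ + 0 → e₂ ≢ + 0 → e₁ + e₂ ≢ + 0 → ∣ e₁ ∣ ℕ.+ ∣ e₂ ∣ ≤ N → ⊥
  refute-pair {e₁ = e₁} {e₂} ⊆uv term-u term-v e₁≢0 e₂≢0 e₁+e₂≢0 bound
    with sum-unique-⊆[u,v] term unique nonempty ⊆uv
  ... | inj₁ S≡u = refute-linear (trans S≡u term-u) e₁≢0 (ℕ.≤-trans (ℕ.m≤m+n (∣ e₁ ∣) (∣ e₂ ∣)) bound)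
  ... | inj₂ (inj₁ S≡v) = refute-linear (trans S≡v term-v) e₂≢0 (ℕ.≤-trans (ℕ.m≤n+m (∣ e₂ ∣) (∣ e₁ ∣)) bound)
  ... | inj₂ (inj₂ S≡u+v) =
    refute-linear (trans S≡u+v (trans (cong₂ _+_ term-u term-v) (sym (ℤ.*-distribʳ-+ w e₁ e₂))))
      e₁+e₂≢0 (ℕ.≤-trans (ℤ.∣i+j∣≤∣i∣+∣j∣ e₁ e₂) bound)

  ∣a∣+∣b∣≤N : ∣ a ∣ ℕ.+ ∣ b ∣ ≤ N
  ∣a∣+∣b∣≤N = ℕ.m≤m+n _ (∣ c ∣)

  ∣a∣+∣c∣≤N : ∣ a ∣ ℕ.+ ∣ c ∣ ≤ N
  ∣a∣+∣c∣≤N = ℕ.+-monoˡ-≤ (∣ c ∣) (ℕ.m≤m+n (∣ a ∣) (∣ b ∣))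

  ∣b∣+∣c∣≤N : ∣ b ∣ ℕ.+ ∣ c ∣ ≤ N
  ∣b∣+∣c∣≤N = subst (∣ b ∣ ℕ.+ ∣ c ∣ ≤_) (sym (ℕ.+-assoc (∣ a ∣) (∣ b ∣) (∣ c ∣))) (ℕ.m≤n+m _ (∣ a ∣))

  exceptional-impossible : Exceptional a b c → ⊥
  exceptional-impossible (only-a-nonzero b≡0 c≡0 a≢0) =
    refute-single ⊆x term-x a≢0 (ℕ.≤-trans (ℕ.m≤m+n (∣ a ∣) (∣ b ∣)) ∣a∣+∣b∣≤N)
    where
    ⊆x : ∀ {α} → α ∈ L → α ≡ x
    ⊆x α∈L with monomial α∈L
    ... | x²∈P = ⊥-elim (x²∉L a≢0 α∈L)
    ... | xy∈P = ⊥-elim (xy∉L (inj₁ a≢0) α∈L)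
    ... | x∈P  = refl
    ... | y∈P  = ⊥-elim (y∉L b≡0 α∈L)
    ... | z∈P  = ⊥-elim (z∉L c≡0 α∈L)
  exceptional-impossible (only-b-nonzero a≡0 c≡0 b≢0) with x² ∈? L
  ... | yes x²∈L = refute-x² ⊆x²
    where
    ⊆x² : ∀ {α} → α ∈ L → α ≡ x²
    ⊆x² α∈L with monomial α∈L
    ... | x²∈P = refl
    ... | xy∈P = ⊥-elim (xy∉L (inj₂ b≢0) α∈L)
    ... | x∈P  = ⊥-elim (x∉L a≡0 α∈L)
    ... | y∈P  = ⊥-elim (x²∈L⇒y∉L x²∈L α∈L)
    ... | z∈P  = ⊥-elim (z∉L c≡0 α∈L)
  ... | no x²∉L′ = refute-single ⊆y term-y b≢0 (ℕ.≤-trans (ℕ.m≤n+m (∣ b ∣) (∣ a ∣)) ∣a∣+∣b∣≤N)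
    where
    ⊆y : ∀ {α} → α ∈ L → α ≡ y
    ⊆y α∈L with monomial α∈L
    ... | x²∈P = ⊥-elim (x²∉L′ α∈L)
    ... | xy∈P = ⊥-elim (xy∉L (inj₂ b≢0) α∈L)
    ... | x∈P  = ⊥-elim (x∉L a≡0 α∈L)
    ... | y∈P  = refl
    ... | z∈P  = ⊥-elim (z∉L c≡0 α∈L)
  exceptional-impossible (only-a-zero a≡0 b≢0 c≢0 b+c≢0) with x² ∈? L
  ... | yes x²∈L = refute-x² ⊆x²
    where
    ⊆x² : ∀ {α} → α ∈ L → α ≡ x²
    ⊆x² α∈L with monomial α∈L
    ... | x²∈P = refl
    ... | xy∈P = ⊥-elim (xy∉L (inj₂ b≢0) α∈L)
    ... | x∈P  = ⊥-elim (x∉L a≡0 α∈L)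
    ... | y∈P  = ⊥-elim (x²∈L⇒y∉L x²∈L α∈L)
    ... | z∈P  = ⊥-elim (x²∈L⇒z∉L x²∈L α∈L)
  ... | no x²∉L′ = refute-pair ⊆yz term-y term-z b≢0 c≢0 b+c≢0 ∣b∣+∣c∣≤N
    where
    ⊆yz : ∀ {α} → α ∈ L → α ≡ y ⊎ α ≡ z
    ⊆yz α∈L with monomial α∈L
    ... | x²∈P = ⊥-elim (x²∉L′ α∈L)
    ... | xy∈P = ⊥-elim (xy∉L (inj₂ b≢0) α∈L)
    ... | x∈P  = ⊥-elim (x∉L a≡0 α∈L)
    ... | y∈P  = inj₁ refl
    ... | z∈P  = inj₂ refl
  exceptional-impossible (only-b-zero b≡0 a≢0 c≢0 a+c≢0) =
    refute-pair ⊆xz term-x term-z a≢0 c≢0 a+c≢0 ∣a∣+∣c∣≤N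
    where
    ⊆xz : ∀ {α} → α ∈ L → α ≡ x ⊎ α ≡ z
    ⊆xz α∈L with monomial α∈L
    ... | x²∈P = ⊥-elim (x²∉L a≢0 α∈L)
    ... | xy∈P = ⊥-elim (xy∉L (inj₁ a≢0) α∈L)
    ... | x∈P  = inj₁ refl
    ... | y∈P  = ⊥-elim (y∉L b≡0 α∈L)
    ... | z∈P  = inj₂ refl
  exceptional-impossible (only-c-zero c≡0 a≢0 b≢0 a+b≢0) =
    refute-pair ⊆xy term-x term-y a≢0 b≢0 a+b≢0 ∣a∣+∣b∣≤N
    where
    ⊆xy : ∀ {α} → α ∈ L → α ≡ x ⊎ α ≡ y
    ⊆xy α∈L with monomial α∈L
    ... | x²∈P = ⊥-elim (x²∉L a≢0 α∈L)
    ... | xy∈P = ⊥-elim (xy∉L (inj₁ a≢0) α∈L)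
    ... | x∈P  = inj₁ refl
    ... | y∈P  = inj₂ refl
    ... | z∈P  = ⊥-elim (z∉L c≡0 α∈L)

exceptional⇒¬rado : ∀ {a b c} → Exceptional a b c → a + b + c ≢ + 0 → ¬ MinimalRadoCondition (Pabc a b c)
exceptional⇒¬rado {a} {b} {c} exceptional sum≢0 rado
  with primes-unbounded (∣ a ∣ ℕ.+ ∣ b ∣ ℕ.+ ∣ c ∣)
... | p , p-prime , p-large with rado p p-prime
... | r₀ , r₀-root , m , r , J , d , (d≥1 , unique , functional) , padic-root
  with P̃-root≡0 {a} {b} {c} {r₀} sum≢0 r₀-root
... | refl with functional 2 log₂-parity 0 0
              | invertibleRoot⇒p∣levelSum₀ {coef = coeffP a b c} {m} {r} {J} {d} d≥1 padic-root
... | (t₁ ∷ t₂ ∷ t₃ ∷ []) , _ , (_ , (t₁≥1 , colour₁) ∷ (t₂≥1 , colour₂) ∷ (_ , colour₃) ∷ []) , determines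
    | w , p∤w , p∣S =
  LowestLevelOfP.exceptional-impossible p-prime p-large t₁≥1 t₂≥1
    (not-double colour₂ colour₁) (not-double colour₃ colour₁)
    (determines⇒lowestLevel unique determines) p∤w p∣S exceptional
  where
  not-double : ∀ {s κ} → log₂-parity s ≡ κ → log₂-parity t₁ ≡ κ → s ≢ t₁ ℕ.+ t₁
  not-double colour-s colour₁ refl = log₂-parity-double t₁≥1 (trans colour-s (sym colour₁))

Conclusion : ℤ → ℤ → ℤ → Set
Conclusion a b c =
    ((a ≡ + 0) × (b ≡ + 0))
    ⊎ ((¬ ((a ≡ + 0) × (b ≡ + 0)) × ¬ ((a ≡ + 0) × (c ≡ + 0)) × ¬ ((b ≡ + 0) × (c ≡ + 0)))
    × ((a + b ≡ + 0) ⊎ (a + c ≡ + 0) ⊎ (b + c ≡ + 0)))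

conclusion-or-exceptional : ∀ a b c → ¬ ((a ≡ + 0) × (b ≡ + 0) × (c ≡ + 0)) →
  (a * b * c ≡ + 0) ⊎ (a + b + c ≡ + 0) → a + b + c ≢ + 0 → Conclusion a b c ⊎ Exceptional a b c
conclusion-or-exceptional a b c not-all-zero abc≡0∨sum≡0 sum≢0
  with a ℤ.≟ + 0 | b ℤ.≟ + 0 | c ℤ.≟ + 0
... | yes a≡0 | yes b≡0 | yes c≡0 = ⊥-elim (not-all-zero (a≡0 , b≡0 , c≡0))
... | yes a≡0 | yes b≡0 | no  _   = inj₁ (inj₁ (a≡0 , b≡0))
... | yes a≡0 | no  b≢0 | yes c≡0 = inj₂ (only-b-nonzero a≡0 c≡0 b≢0)
... | no  a≢0 | yes b≡0 | yes c≡0 = inj₂ (only-a-nonzero b≡0 c≡0 a≢0)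
... | yes a≡0 | no  b≢0 | no  c≢0 = Sum.map
  (λ b+c≡0 → inj₂ ((b≢0 ∘ proj₂ , c≢0 ∘ proj₂ , b≢0 ∘ proj₁) , inj₂ (inj₂ b+c≡0)))
  (only-a-zero a≡0 b≢0 c≢0) (toSum (b + c ℤ.≟ + 0))
... | no  a≢0 | yes b≡0 | no  c≢0 = Sum.map
  (λ a+c≡0 → inj₂ ((a≢0 ∘ proj₁ , a≢0 ∘ proj₁ , c≢0 ∘ proj₂) , inj₂ (inj₁ a+c≡0)))
  (only-b-zero b≡0 a≢0 c≢0) (toSum (a + c ℤ.≟ + 0))
... | no  a≢0 | no  b≢0 | yes c≡0 = Sum.map
  (λ a+b≡0 → inj₂ ((a≢0 ∘ proj₁ , a≢0 ∘ proj₁ , b≢0 ∘ proj₁) , inj₁ a+b≡0))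
  (only-c-zero c≡0 a≢0 b≢0) (toSum (a + b ℤ.≟ + 0))
... | no  a≢0 | no  b≢0 | no  c≢0 = ⊥-elim ([ abc≢0 , sum≢0 ]′ abc≡0∨sum≡0)
  where
  abc≢0 : a * b * c ≢ + 0
  abc≢0 abc≡0 = [ [ a≢0 , b≢0 ]′ ∘ i*j≡0⇒i≡0∨j≡0 a , c≢0 ]′ (i*j≡0⇒i≡0∨j≡0 (a * b) abc≡0)

lemma5p1 : (a b c : ℤ) →
    ¬ ((a ≡ + 0) × (b ≡ + 0) × (c ≡ + 0)) →
    ((a * b * c ≡ + 0) ⊎ (a + b + c ≡ + 0)) →
    a + b + c ≢ + 0 →
    MinimalRadoCondition (Pabc a b c) →
    ((a ≡ + 0) × (b ≡ + 0))
    ⊎ ((¬ ((a ≡ + 0) × (b ≡ + 0)) × ¬ ((a ≡ + 0) × (c ≡ + 0)) × ¬ ((b ≡ + 0) × (c ≡ + 0)))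
       × ((a + b ≡ + 0) ⊎ (a + c ≡ + 0) ⊎ (b + c ≡ + 0)))
lemma5p1 a b c not-all-zero abc≡0∨sum≡0 sum≢0 rado =
  Sum.fromInj₁ (λ exceptional → ⊥-elim (exceptional⇒¬rado exceptional sum≢0 rado))
    (conclusion-or-exceptional a b c not-all-zero abc≡0∨sum≡0 sum≢0)
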